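{- In the standing setup of the context, every ordinary vertex that is adjacent to some small vertex is adjacent to every large vertex other than itself.
   Context: Loop-free multigraph: finite undirected graph without loops, multiple edges between distinct vertices allowed. The type of an edge joining $u,v$ is $\{u,v\}$; its multiplicity is the number of edges of that type; an edge/type is simple if its multiplicity is one and non-simple if at least two; a graph is simple if all edges are simple. Two vertices are adjacent if there is at least one edge between them. Double edge swap $(a_1,a_2)(a_3,a_4)$: remove two distinct edges of types $\{a_1,a_2\},\{a_3,a_4\}$ and add edges of types $\{a_2,a_3\},\{a_4,a_1\}$; admissible if the removed edges share no endpoint and not both are simple. Orders: fix finite $V$ and $d:V\to\mathbb{N}$, and a total order $<$ on $V$ with $d(u)<d(v)\Rightarrow u<v$. For $u_1>u_2$, $v_1>v_2$ set $\{u_1,u_2\}\le\{v_1,v_2\}$ iff $u_1<v_1$ or ($u_1=v_1$ and $u_2\le v_2$). For loop-free multigraphs on $V$ with degrees $d$: $G'<G$ iff $G$ is not simple and either the maximal non-simple type of $G$ is larger than all non-simple types of $G'$, or the maximal non-simple types of $G'$ and $G$ coincide and its multiplicity is strictly larger in $G$ than in $G'$. Standing setup: $G$ is a non-simple loop-free multigraph on $V$ with $\deg_G v=d(v)$ for all $v$, such that no finite sequence of admissible double edge swaps transforms $G$ into a graph $G'$ with $G'<G$. Let $\{u_1,u_2\}$, $u_1>u_2$, be the maximal non-simple type of $G$. Vertices other than $u_1,u_2$ are ordinary. For $i=1,2$, $V_i$ is the set of ordinary vertices adjacent to $u_i$ and $\overline{V_i}$ the set of ordinary vertices not adjacent to $u_i$.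 An ordinary vertex is small if it is smaller than $u_1$ and large if it is larger than $u_1$. -}

module Defs where

open import Data.Nat as ℕ using (ℕ; _≤_)
open import Data.Fin using (Fin; _<_)
open import Data.Vec using (tabulate; sum)
open import Data.Product using (Σ; _×_; ∃; ∃-syntax; _,_)
open import Data.Sum using (_⊎_)
open import Relation.Binary.PropositionalEquality using (_≡_; _≢_)
open import Relation.Binary.Construct.Closure.ReflexiveTransitive using (Star)
open import Relation.Nullary using (¬_)

-- A multigraph on the vertex set Fin n is given by its multiplicity function:
-- Mult n u v = number of edges of type {u,v}.
Mult : ℕ → Set
Mult n = Fin n → Fin n → ℕ

IsLoopFree : ∀ {n} → Mult n → Set
IsLoopFree {n} m = (∀ u v → m u v ≡ m v u) × (∀ v → m v v ≡ 0)

deg : ∀ {n} → Mult n → Fin n → ℕ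
deg m v = sum (tabulate (m v))

Adj : ∀ {n} → Mult n → Fin n → Fin n → Set
Adj m u v = 1 ≤ m u v

δ : ∀ {n} → Fin n → Fin n → Fin n → Fin n → ℕ
δ a b x y with a Data.Fin.≟ x | b Data.Fin.≟ y | a Data.Fin.≟ y | b Data.Fin.≟ x
... | Relation.Nullary.yes _ | Relation.Nullary.yes _ | _ | _ = 1
... | _ | _ | Relation.Nullary.yes _ | Relation.Nullary.yes _ = 1
... | _ | _ | _ | _ = 0

-- admissible double edge swap (a1,a2)(a3,a4) transforming m into m':
-- a1,a2,a3,a4 pairwise distinct (removed edges share no endpoint, no loops),
-- both removed edge types present, not both simple, and
-- m' = m - {a1,a2} - {a3,a4} + {a2,a3} + {a4,a1}.
AdmSwap : ∀ {n} → Mult n → Mult n → Set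
AdmSwap {n} m m' = Σ (Fin n) λ a1 → Σ (Fin n) λ a2 → Σ (Fin n) λ a3 → Σ (Fin n) λ a4 →
  (a1 ≢ a2) × (a1 ≢ a3) × (a1 ≢ a4) × (a2 ≢ a3) × (a2 ≢ a4) × (a3 ≢ a4) ×
  (1 ≤ m a1 a2) × (1 ≤ m a3 a4) × ((2 ≤ m a1 a2) ⊎ (2 ≤ m a3 a4)) ×
  (∀ x y → m' x y ℕ.+ δ a1 a2 x y ℕ.+ δ a3 a4 x y ≡ m x y ℕ.+ δ a2 a3 x y ℕ.+ δ a4 a1 x y)

Reachable : ∀ {n} → Mult n → Mult n → Set
Reachable = Star AdmSwap

-- order on types {v1,v2} (v1 > v2) vs {u1,u2} (u1 > u2)
TypeLe : ∀ {n} → Fin n → Fin n → Fin n → Fin n → Set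
TypeLe v1 v2 u1 u2 = (v1 < u1) ⊎ ((v1 ≡ u1) × (Data.Fin._≤_ v2 u2))

TypeLt : ∀ {n} → Fin n → Fin n → Fin n → Fin n → Set
TypeLt v1 v2 u1 u2 = (v1 < u1) ⊎ ((v1 ≡ u1) × (v2 < u2))

IsMaxNonSimple : ∀ {n} → Mult n → Fin n → Fin n → Set
IsMaxNonSimple m u1 u2 =
  (u2 < u1) × (2 ≤ m u1 u2) ×
  (∀ v1 v2 → v2 < v1 → 2 ≤ m v1 v2 → TypeLe v1 v2 u1 u2)

_≺_ : ∀ {n} → Mult n → Mult n → Set
_≺_ {n} G' G = Σ (Fin n) λ u1 → Σ (Fin n) λ u2 → IsMaxNonSimple G u1 u2 ×
  ( (∀ v1 v2 → v2 < v1 → 2 ≤ G' v1 v2 → TypeLt v1 v2 u1 u2)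
  ⊎ (IsMaxNonSimple G' u1 u2 × (G' u1 u2 ℕ.< G u1 u2)))

-- Suppose x (adjacent to a small vertex s) is not adjacent to a large vertex y. Every edge at y is
-- simple, since y exceeds both ends of the maximal non-simple type {u1,u2}; and y has a neighbour w
-- that is not a neighbour of u1, for otherwise deg y < deg u1 although u1 < y. The swap
-- (u1,u2)(y,w) lowers the multiplicity of {u1,u2} and creates only simple edges, except that
-- {u2,y} becomes double when u2 and y were already adjacent; in that case the further swap
-- (u2,y)(x,s) restores it, creating the edge {y,x} and edges of the small type {s,u2}. Either way
-- G is reduced, which the hypothesis forbids.
module Submission where

open import Defs
import Data.Nat
open import Data.Nat as ℕ using (ℕ; suc; _≤_; _+_; _∸_; z≤n; s≤s)
import Data.Nat.Properties as ℕₚ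
open import Data.Nat.Properties
  using (≤-trans; ≤-reflexive; ≤-<-trans; <-≤-trans; +-comm; +-identityʳ; m≤m+n; <⇒≱; ≰⇒>;
         n≢0⇒n>0; +-0-commutativeMonoid)
open import Data.Fin as Fin using (Fin; _<_; _≟_)
import Data.Fin.Properties as Fin
import Data.Fin.Permutation as Perm
import Data.Fin.Permutation.Components as PC
open import Algebra.Properties.CommutativeMonoid.Sum +-0-commutativeMonoid using (sum; sum-permute)
import Data.Vec as Vec
open import Data.Product using (Σ; ∃; _×_; _,_; proj₁; proj₂)
open import Data.Sum using (_⊎_; inj₁; inj₂)
open import Data.Empty using (⊥-elim)
open import Function using (_∘_)
open import Relation.Binary.PropositionalEquality
open import Relation.Binary.Definitions using (tri<; tri≈; tri>)
open import Relation.Binary.Construct.Closure.ReflexiveTransitive using (ε; _◅_)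
open import Relation.Nullary using (¬_; yes; no; Dec; contradiction)
open import Relation.Nullary.Decidable using (_×-dec_; _⊎-dec_; ¬?; dec-true; dec-false)

private
  variable
    n : ℕ

SameType : Fin n → Fin n → Fin n → Fin n → Set
SameType a b p q = (a ≡ p × b ≡ q) ⊎ (a ≡ q × b ≡ p)

sameType? : (a b p q : Fin n) → Dec (SameType a b p q)
sameType? a b p q = (a ≟ p ×-dec b ≟ q) ⊎-dec (a ≟ q ×-dec b ≟ p)

module _ {a b : Fin n} where

  SameType-flip : ∀ {p q} → SameType a b p q → SameType b a p q
  SameType-flip (inj₁ (a≡p , b≡q)) = inj₂ (b≡q , a≡p)
  SameType-flip (inj₂ (a≡q , b≡p)) = inj₁ (b≡p , a≡q)

  SameType-swap : ∀ {p q} → SameType a b p q → SameType a b q p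
  SameType-swap (inj₁ (a≡p , b≡q)) = inj₂ (a≡p , b≡q)
  SameType-swap (inj₂ (a≡q , b≡p)) = inj₁ (a≡q , b≡p)

  SameType-miss : ∀ {c d p q} → SameType c d p q → c ≢ a → c ≢ b → ¬ SameType a b p q
  SameType-miss (inj₁ (refl , refl)) c≢a c≢b (inj₁ (a≡c , _)) = c≢a (sym a≡c)
  SameType-miss (inj₁ (refl , refl)) c≢a c≢b (inj₂ (_ , b≡c)) = c≢b (sym b≡c)
  SameType-miss (inj₂ (refl , refl)) c≢a c≢b (inj₁ (_ , b≡c)) = c≢b (sym b≡c)
  SameType-miss (inj₂ (refl , refl)) c≢a c≢b (inj₂ (a≡c , _)) = c≢a (sym a≡c)

  SameType-missˡ : ∀ {p q} → p ≢ a → p ≢ b → ¬ SameType a b p q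
  SameType-missˡ = SameType-miss (inj₁ (refl , refl))

  SameType-missʳ : ∀ {p q} → q ≢ a → q ≢ b → ¬ SameType a b p q
  SameType-missʳ = SameType-miss (inj₂ (refl , refl))

  δ-same : ∀ {p q} → SameType a b p q → δ a b p q ≡ 1
  δ-same (inj₁ (refl , refl)) with a ≟ a | b ≟ b
  ... | yes _  | yes _  = refl
  ... | no a≢a | _      = contradiction refl a≢a
  ... | _      | no b≢b = contradiction refl b≢b
  δ-same (inj₂ (refl , refl)) with a ≟ b | b ≟ a | a ≟ a | b ≟ b
  ... | yes _ | yes _ | _      | _      = refl
  ... | yes _ | no _  | yes _  | yes _  = refl
  ... | no _  | _     | yes _  | yes _  = refl
  ... | _     | _     | no a≢a | _      = contradiction refl a≢a
  ... | _     | _     | _      | no b≢b = contradiction refl b≢b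

  δ-other : ∀ {p q} → ¬ SameType a b p q → δ a b p q ≡ 0
  δ-other {p} {q} ¬t with a ≟ p | b ≟ q | a ≟ q | b ≟ p
  ... | yes a≡p | yes b≡q | _       | _       = contradiction (inj₁ (a≡p , b≡q)) ¬t
  ... | _       | _       | yes a≡q | yes b≡p = contradiction (inj₂ (a≡q , b≡p)) ¬t
  ... | yes _   | no _    | yes _   | no _    = refl
  ... | yes _   | no _    | no _    | _       = refl
  ... | no _    | _       | yes _   | no _    = refl
  ... | no _    | _       | no _    | _       = refl

  δ-sym : ∀ p q → δ a b p q ≡ δ a b q p
  δ-sym p q with sameType? a b p q
  ... | yes t  = trans (δ-same t) (sym (δ-same (SameType-swap t)))
  ... | no ¬t = trans (δ-other ¬t) (sym (δ-other (¬t ∘ SameType-swap)))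

IsSymmetric : Mult n → Set
IsSymmetric m = ∀ u v → m u v ≡ m v u

mult-type : ∀ {m : Mult n} → IsSymmetric m → ∀ {a b p q} → SameType a b p q → m a b ≡ m p q
mult-type symmetric (inj₁ (refl , refl)) = refl
mult-type symmetric (inj₂ (refl , refl)) = symmetric _ _

sum-mono-≤ : ∀ {f g : Fin n → ℕ} → (∀ i → f i ≤ g i) → sum f ≤ sum g
sum-mono-≤ {ℕ.zero}  f≤g = z≤n
sum-mono-≤ {suc n}   f≤g = ℕₚ.+-mono-≤ (f≤g Fin.zero) (sum-mono-≤ (f≤g ∘ Fin.suc))

sum-mono-< : ∀ {f g : Fin n → ℕ} → (∀ i → f i ≤ g i) → ∀ c → f c ℕ.< g c → sum f ℕ.< sum g
sum-mono-< f≤g Fin.zero    fc<gc = ℕₚ.+-mono-<-≤ fc<gc (sum-mono-≤ (f≤g ∘ Fin.suc))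
sum-mono-< f≤g (Fin.suc c) fc<gc = ℕₚ.+-mono-≤-< (f≤g Fin.zero) (sum-mono-< (f≤g ∘ Fin.suc) c fc<gc)

sum-tabulate : ∀ (f : Fin n → ℕ) → Vec.sum (Vec.tabulate f) ≡ sum f
sum-tabulate {ℕ.zero} f = refl
sum-tabulate {suc n}  f = cong (f Fin.zero +_) (sum-tabulate (f ∘ Fin.suc))

module _ {i j : Fin n} where

  transpose-ˡ : PC.transpose i j i ≡ j
  transpose-ˡ rewrite dec-true (i ≟ i) refl = refl

  transpose-ʳ : PC.transpose i j j ≡ i
  transpose-ʳ with j ≟ i
  ... | yes refl = refl
  ... | no _ rewrite dec-true (j ≟ j) refl = refl

  transpose-≢ : ∀ {k} → k ≢ i → k ≢ j → PC.transpose i j k ≡ k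
  transpose-≢ {k} k≢i k≢j rewrite dec-false (k ≟ i) k≢i | dec-false (k ≟ j) k≢j = refl

-- Transposing a and b lines up the edges {a,b}, which are counted in both degrees.
deg-< : ∀ {G : Mult n} → IsLoopFree G → ∀ {a b c} → c ≢ a → c ≢ b →
        G a c ℕ.< G b c → (∀ w → w ≢ a → w ≢ b → G a w ≤ G b w) → deg G a ℕ.< deg G b
deg-< {G = G} (symmetric , loopless) {a} {b} {c} c≢a c≢b Gac<Gbc dominated = begin-strict
  deg G a                       ≡⟨ sum-tabulate (G a) ⟩
  sum (G a)                     ≡⟨ sum-permute (G a) (Perm.transpose a b) ⟩
  sum (G a ∘ PC.transpose a b)  <⟨ sum-mono-< pointwise c at-c ⟩
  sum (G b)                     ≡⟨ sum-tabulate (G b) ⟨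
  deg G b                       ∎
  where
  open ℕₚ.≤-Reasoning
  at-c : G a (PC.transpose a b c) ℕ.< G b c
  at-c rewrite transpose-≢ c≢a c≢b = Gac<Gbc
  pointwise : ∀ w → G a (PC.transpose a b w) ≤ G b w
  pointwise w = by-cases (w ≟ a) (w ≟ b)
    where
    by-cases : Dec (w ≡ a) → Dec (w ≡ b) → G a (PC.transpose a b w) ≤ G b w
    by-cases (yes refl) _ rewrite transpose-ˡ {i = a} {b} = ≤-reflexive (symmetric a b)
    by-cases (no _) (yes refl) rewrite transpose-ʳ {i = a} {b} | loopless a | loopless b = z≤n
    by-cases (no w≢a) (no w≢b) rewrite transpose-≢ w≢a w≢b = dominated w w≢a w≢b

record Distinct₄ (a1 a2 a3 a4 : Fin n) : Set where
  constructor distinct₄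
  field
    a1≢a2 : a1 ≢ a2
    a1≢a3 : a1 ≢ a3
    a1≢a4 : a1 ≢ a4
    a2≢a3 : a2 ≢ a3
    a2≢a4 : a2 ≢ a4
    a3≢a4 : a3 ≢ a4

-- The truncated subtraction is exact as soon as both removed edges are present (swap-equation).
swap : Mult n → Fin n → Fin n → Fin n → Fin n → Mult n
swap m a1 a2 a3 a4 p q = m p q + δ a2 a3 p q + δ a4 a1 p q ∸ (δ a1 a2 p q + δ a3 a4 p q)

module _ (m : Mult n) (a1 a2 a3 a4 : Fin n) where

  private
    m′ = swap m a1 a2 a3 a4
    open ℕₚ.≤-Reasoning

    m≤m+n+o : ∀ k i j → k ≤ k + i + j
    m≤m+n+o k i j = ≤-trans (m≤m+n k i) (m≤m+n (k + i) j)

  swap-sym : IsSymmetric m → IsSymmetric m′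
  swap-sym symmetric p q
    rewrite symmetric p q | δ-sym {a = a1} {a2} p q | δ-sym {a = a2} {a3} p q
          | δ-sym {a = a3} {a4} p q | δ-sym {a = a4} {a1} p q = refl

  swap-≤ : ∀ p q → m′ p q ≤ m p q + δ a2 a3 p q + δ a4 a1 p q
  swap-≤ p q = ℕₚ.m∸n≤m _ (δ a1 a2 p q + δ a3 a4 p q)

  swap-≥ : ∀ p q → m p q + δ a2 a3 p q + δ a4 a1 p q ≤ m′ p q + (δ a1 a2 p q + δ a3 a4 p q)
  swap-≥ p q = ≤-trans (ℕₚ.m≤n+m∸n _ removed) (≤-reflexive (+-comm removed _))
    where removed = δ a1 a2 p q + δ a3 a4 p q

  swap-≤-not-added : ∀ {p q} → ¬ SameType a2 a3 p q → ¬ SameType a4 a1 p q → m′ p q ≤ m p q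
  swap-≤-not-added {p} {q} ¬t₂₃ ¬t₄₁ = begin
    m′ p q                              ≤⟨ swap-≤ p q ⟩
    m p q + δ a2 a3 p q + δ a4 a1 p q   ≡⟨ cong₂ (λ i j → m p q + i + j) (δ-other ¬t₂₃) (δ-other ¬t₄₁) ⟩
    m p q + 0 + 0                       ≡⟨ trans (+-identityʳ _) (+-identityʳ _) ⟩
    m p q                               ∎

  swap-≥-not-removed : ∀ {p q} → ¬ SameType a1 a2 p q → ¬ SameType a3 a4 p q → m p q ≤ m′ p q
  swap-≥-not-removed {p} {q} ¬t₁₂ ¬t₃₄ = begin
    m p q                                      ≤⟨ m≤m+n+o (m p q) _ _ ⟩
    m p q + δ a2 a3 p q + δ a4 a1 p q          ≤⟨ swap-≥ p q ⟩
    m′ p q + (δ a1 a2 p q + δ a3 a4 p q)       ≡⟨ cong₂ (λ i j → m′ p q + (i + j)) (δ-other ¬t₁₂) (δ-other ¬t₃₄) ⟩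
    m′ p q + 0                                 ≡⟨ +-identityʳ _ ⟩
    m′ p q                                     ∎

  module _ (distinct : Distinct₄ a1 a2 a3 a4) where

    open Distinct₄ distinct

    swap-≤-added : ∀ {p q} → SameType a2 a3 p q ⊎ SameType a4 a1 p q → m′ p q ≤ suc (m p q)
    swap-≤-added {p} {q} (inj₁ t₂₃) = begin
      m′ p q                              ≤⟨ swap-≤ p q ⟩
      m p q + δ a2 a3 p q + δ a4 a1 p q   ≡⟨ cong₂ (λ i j → m p q + i + j) (δ-same t₂₃)
                                                 (δ-other (SameType-miss t₂₃ a2≢a4 (a1≢a2 ∘ sym))) ⟩
      m p q + 1 + 0                       ≡⟨ trans (+-identityʳ _) (+-comm _ 1) ⟩
      suc (m p q)                         ∎
    swap-≤-added {p} {q} (inj₂ t₄₁) = begin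
      m′ p q                              ≤⟨ swap-≤ p q ⟩
      m p q + δ a2 a3 p q + δ a4 a1 p q   ≡⟨ cong₂ (λ i j → m p q + i + j)
                                                 (δ-other (SameType-miss t₄₁ (a2≢a4 ∘ sym) (a3≢a4 ∘ sym)))
                                                 (δ-same t₄₁) ⟩
      m p q + 0 + 1                       ≡⟨ trans (cong (_+ 1) (+-identityʳ _)) (+-comm _ 1) ⟩
      suc (m p q)                         ∎

    swap-adds : m a2 a3 ℕ.< m′ a2 a3
    swap-adds = begin-strict
      m a2 a3                                       <⟨ ℕₚ.n<1+n _ ⟩
      suc (m a2 a3)                                 ≡⟨ +-comm 1 _ ⟩
      m a2 a3 + 1                                   ≡⟨ cong (m a2 a3 +_) (δ-same (inj₁ (refl , refl))) ⟨
      m a2 a3 + δ a2 a3 a2 a3                       ≤⟨ m≤m+n _ _ ⟩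
      m a2 a3 + δ a2 a3 a2 a3 + δ a4 a1 a2 a3       ≤⟨ swap-≥ a2 a3 ⟩
      m′ a2 a3 + (δ a1 a2 a2 a3 + δ a3 a4 a2 a3)    ≡⟨ cong₂ (λ i j → m′ a2 a3 + (i + j))
                                                         (δ-other (SameType-missʳ (a1≢a3 ∘ sym) (a2≢a3 ∘ sym)))
                                                         (δ-other (SameType-missˡ a2≢a3 a2≢a4)) ⟩
      m′ a2 a3 + 0                                  ≡⟨ +-identityʳ _ ⟩
      m′ a2 a3                                      ∎

    module _ (symmetric : IsSymmetric m) (present₁₂ : 1 ≤ m a1 a2) (present₃₄ : 1 ≤ m a3 a4) where

      removed-≤ : ∀ p q → δ a1 a2 p q + δ a3 a4 p q ≤ m p q
      removed-≤ p q with sameType? a1 a2 p q | sameType? a3 a4 p q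
      ... | yes t₁₂ | _ rewrite δ-same t₁₂ | δ-other (SameType-miss t₁₂ a1≢a3 a1≢a4) =
        ≤-trans present₁₂ (≤-reflexive (mult-type symmetric t₁₂))
      ... | no ¬t₁₂ | yes t₃₄ rewrite δ-other ¬t₁₂ | δ-same t₃₄ =
        ≤-trans present₃₄ (≤-reflexive (mult-type symmetric t₃₄))
      ... | no ¬t₁₂ | no ¬t₃₄ rewrite δ-other ¬t₁₂ | δ-other ¬t₃₄ = z≤n

      swap-equation : ∀ p q → m′ p q + δ a1 a2 p q + δ a3 a4 p q ≡ m p q + δ a2 a3 p q + δ a4 a1 p q
      swap-equation p q = trans (ℕₚ.+-assoc (m′ p q) (δ a1 a2 p q) (δ a3 a4 p q))
        (ℕₚ.m∸n+n≡m (≤-trans (removed-≤ p q) (m≤m+n+o (m p q) (δ a2 a3 p q) (δ a4 a1 p q))))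

      swap-admissible : 2 ≤ m a1 a2 ⊎ 2 ≤ m a3 a4 → AdmSwap m m′
      swap-admissible nonSimple = a1 , a2 , a3 , a4 , a1≢a2 , a1≢a3 , a1≢a4 , a2≢a3 , a2≢a4 , a3≢a4 ,
        present₁₂ , present₃₄ , nonSimple , swap-equation

      swap-removes : m′ a1 a2 ℕ.< m a1 a2
      swap-removes = begin-strict
        m′ a1 a2                                   <⟨ ℕₚ.n<1+n _ ⟩
        suc (m′ a1 a2)                             ≡⟨ +-comm 1 _ ⟩
        m′ a1 a2 + 1                               ≡⟨ cong (m′ a1 a2 +_) (δ-same (inj₁ (refl , refl))) ⟨
        m′ a1 a2 + δ a1 a2 a1 a2                   ≤⟨ m≤m+n _ _ ⟩
        m′ a1 a2 + δ a1 a2 a1 a2 + δ a3 a4 a1 a2   ≡⟨ swap-equation a1 a2 ⟩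
        m a1 a2 + δ a2 a3 a1 a2 + δ a4 a1 a1 a2    ≡⟨ cong₂ (λ i j → m a1 a2 + i + j)
                                                        (δ-other (SameType-missˡ a1≢a2 a1≢a3))
                                                        (δ-other (SameType-missʳ a2≢a4 (a1≢a2 ∘ sym))) ⟩
        m a1 a2 + 0 + 0                            ≡⟨ trans (+-identityʳ _) (+-identityʳ _) ⟩
        m a1 a2                                    ∎

≺-intro : ∀ {G G' : Mult n} {u1 u2} → IsMaxNonSimple G u1 u2 → G' u1 u2 ℕ.< G u1 u2 →
          (∀ p q → q < p → 2 ≤ G' p q → TypeLe p q u1 u2) → G' ≺ G
≺-intro {G' = G'} {u1} {u2} maximal@(u2<u1 , _) decreases below with 2 ℕ.≤? G' u1 u2
... | yes nonSimple = u1 , u2 , maximal , inj₂ ((u2<u1 , nonSimple , below) , decreases)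
... | no simple      = u1 , u2 , maximal , inj₁ strictlyBelow
  where
  strictlyBelow : ∀ v1 v2 → v2 < v1 → 2 ≤ G' v1 v2 → TypeLt v1 v2 u1 u2
  strictlyBelow v1 v2 v2<v1 nonSimple with below v1 v2 v2<v1 nonSimple
  ... | inj₁ v1<u1 = inj₁ v1<u1
  ... | inj₂ (refl , v2≤u2) with v2 ≟ u2
  ...   | yes refl = contradiction nonSimple simple
  ...   | no v2≢u2 = inj₂ (refl , Fin.≤∧≢⇒< v2≤u2 v2≢u2)

TypeLe-top : ∀ {v1 v2 u1 u2 : Fin n} → TypeLe v1 v2 u1 u2 → v1 Fin.≤ u1
TypeLe-top (inj₁ v1<u1)      = ℕₚ.<⇒≤ v1<u1
TypeLe-top (inj₂ (refl , _)) = ℕₚ.≤-refl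

module StandingSetup {G : Mult n} (loopFree : IsLoopFree G) {u1 u2 : Fin n}
                     (maximal : IsMaxNonSimple G u1 u2) where

  private
    symmetric      = proj₁ loopFree
    loopless       = proj₂ loopFree
    u2<u1          = proj₁ maximal
    u1u2-nonSimple = proj₁ (proj₂ maximal)
    below-max      = proj₂ (proj₂ maximal)

    u1≢u2 : u1 ≢ u2
    u1≢u2 = ≢-sym (Fin.<⇒≢ u2<u1)

    ¬nonSimple : ∀ {k} → 2 ≤ k → ¬ k ≤ 1
    ¬nonSimple = <⇒≱

  simple-above : ∀ {y} → u1 < y → ∀ z → G y z ≤ 1
  simple-above {y} u1<y z with 2 ℕ.≤? G y z
  ... | no ¬nonSimple = ℕₚ.≤-pred (≰⇒> ¬nonSimple)
  ... | yes nonSimple with Fin.<-cmp z y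
  ...   | tri< z<y _ _ = ⊥-elim (<⇒≱ u1<y (TypeLe-top (below-max y z z<y nonSimple)))
  ...   | tri≈ _ refl _ = ⊥-elim (¬nonSimple nonSimple (≤-trans (≤-reflexive (loopless y)) z≤n))
  ...   | tri> _ _ y<z = ⊥-elim (<⇒≱ (ℕₚ.<-trans u1<y y<z)
                           (TypeLe-top (below-max z y y<z (subst (2 ≤_) (symmetric y z) nonSimple))))

  -- Otherwise u1 dominates y edgewise, strictly at u2, so deg y < deg u1.
  private-neighbour : (∀ u v → deg G u ℕ.< deg G v → u < v) → ∀ {y} → u1 < y →
                      ∃ λ w → Adj G y w × w ≢ u1 × G u1 w ≡ 0
  private-neighbour degree-order {y} u1<y
    with Fin.any? (λ w → (1 ℕ.≤? G y w) ×-dec (¬? (w ≟ u1) ×-dec (G u1 w ℕ.≟ 0)))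
  ... | yes found = found
  ... | no none   = contradiction (degree-order y u1 deg-y<deg-u1) (ℕₚ.<-asym u1<y)
    where
    dominated : ∀ w → w ≢ y → w ≢ u1 → G y w ≤ G u1 w
    dominated w _ w≢u1 with G u1 w ℕ.≟ 0 | 1 ℕ.≤? G y w
    ... | yes Gu1w≡0 | yes y~w = contradiction (w , y~w , w≢u1 , Gu1w≡0) none
    ... | yes _      | no y≁w  = ≤-trans (ℕₚ.≤-pred (≰⇒> y≁w)) z≤n
    ... | no Gu1w≢0  | _       = ≤-trans (simple-above u1<y w) (n≢0⇒n>0 Gu1w≢0)
    deg-y<deg-u1 : deg G y ℕ.< deg G u1
    deg-y<deg-u1 = deg-< loopFree (Fin.<⇒≢ (ℕₚ.<-trans u2<u1 u1<y)) (≢-sym u1≢u2)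
                     (<-≤-trans (s≤s (simple-above u1<y u2)) u1u2-nonSimple) dominated

  module Reduction {x s y w : Fin n}
    (x≢u1 : x ≢ u1) (x≢u2 : x ≢ u2) (s≢u2 : s ≢ u2) (s<u1 : s < u1) (x~s : Adj G x s)
    (u1<y : u1 < y) (y≢x : y ≢ x) (Gxy≡0 : G x y ≡ 0)
    (y~w : Adj G y w) (w≢u1 : w ≢ u1) (Gu1w≡0 : G u1 w ≡ 0) where

    private
      u1≢y : u1 ≢ y
      u1≢y = Fin.<⇒≢ u1<y
      u2≢y : u2 ≢ y
      u2≢y = Fin.<⇒≢ (ℕₚ.<-trans u2<u1 u1<y)
      s≢u1 : s ≢ u1
      s≢u1 = Fin.<⇒≢ s<u1
      s≢y : s ≢ y
      s≢y = Fin.<⇒≢ (ℕₚ.<-trans s<u1 u1<y)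
      y≢w : y ≢ w
      y≢w refl = <⇒≱ y~w (≤-reflexive (loopless y))
      x≢s : x ≢ s
      x≢s refl = <⇒≱ x~s (≤-reflexive (loopless x))
      u2≢w : u2 ≢ w
      u2≢w refl = <⇒≱ u1u2-nonSimple (≤-trans (≤-reflexive Gu1w≡0) z≤n)
      x≢w : x ≢ w
      x≢w refl = <⇒≱ y~w (≤-reflexive (trans (symmetric y x) Gxy≡0))

      absent : ∀ {a b p q} → SameType a b p q → G a b ≡ 0 → G p q ≡ 0
      absent t Gab≡0 = trans (sym (mult-type symmetric t)) Gab≡0

      distinct₁ : Distinct₄ u1 u2 y w
      distinct₁ = distinct₄ u1≢u2 u1≢y (≢-sym w≢u1) u2≢y u2≢w y≢w

      distinct₂ : Distinct₄ u2 y x s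
      distinct₂ = distinct₄ u2≢y (≢-sym x≢u2) (≢-sym s≢u2) y≢x (≢-sym s≢y) x≢s

    G₁ : Mult n
    G₁ = swap G u1 u2 y w

    G₁-admissible : AdmSwap G G₁
    G₁-admissible = swap-admissible G u1 u2 y w distinct₁ symmetric
                      (≤-trans (s≤s z≤n) u1u2-nonSimple) y~w (inj₁ u1u2-nonSimple)

    G₁-decreases : G₁ u1 u2 ℕ.< G u1 u2
    G₁-decreases = swap-removes G u1 u2 y w distinct₁ symmetric (≤-trans (s≤s z≤n) u1u2-nonSimple) y~w

    G₁-≺ : G u2 y ≡ 0 → G₁ ≺ G
    G₁-≺ Gu2y≡0 = ≺-intro maximal G₁-decreases below
      where
      below : ∀ p q → q < p → 2 ≤ G₁ p q → TypeLe p q u1 u2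
      below p q q<p nonSimple with sameType? u2 y p q | sameType? w u1 p q
      ... | yes t | _ = contradiction (subst (λ k → G₁ p q ≤ suc k) (absent t Gu2y≡0)
                          (swap-≤-added G u1 u2 y w distinct₁ (inj₁ t))) (¬nonSimple nonSimple)
      ... | _ | yes t = contradiction (subst (λ k → G₁ p q ≤ suc k) (absent t (trans (symmetric w u1) Gu1w≡0))
                          (swap-≤-added G u1 u2 y w distinct₁ (inj₂ t))) (¬nonSimple nonSimple)
      ... | no ¬u2y | no ¬wu1 =
        below-max p q q<p (≤-trans nonSimple (swap-≤-not-added G u1 u2 y w ¬u2y ¬wu1))

    G₂ : Mult n
    G₂ = swap G₁ u2 y x s

    module _ (u2~y : Adj G u2 y) where

      private
        G₁-symmetric : IsSymmetric G₁
        G₁-symmetric = swap-sym G u1 u2 y w symmetric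

        u2y-nonSimple : 2 ≤ G₁ u2 y
        u2y-nonSimple = ≤-trans (s≤s u2~y) (swap-adds G u1 u2 y w distinct₁)

        xs-present : 1 ≤ G₁ x s
        xs-present = ≤-trans x~s
          (swap-≥-not-removed G u1 u2 y w (SameType-missˡ x≢u1 x≢u2) (SameType-missˡ (≢-sym y≢x) x≢w))

      G₂-admissible : AdmSwap G₁ G₂
      G₂-admissible = swap-admissible G₁ u2 y x s distinct₂ G₁-symmetric
                        (≤-trans (s≤s z≤n) u2y-nonSimple) xs-present (inj₁ u2y-nonSimple)

      G₂-decreases : G₂ u1 u2 ℕ.< G u1 u2
      G₂-decreases = ≤-<-trans
        (swap-≤-not-added G₁ u2 y x s (SameType-missˡ u1≢y (≢-sym x≢u1)) (SameType-missˡ (≢-sym s≢u1) u1≢u2))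
        G₁-decreases

      G₂-≺ : G₂ ≺ G
      G₂-≺ = ≺-intro maximal G₂-decreases below
        where
        removed-again : G₂ u2 y ≤ 1
        removed-again = ℕₚ.≤-pred (<-≤-trans
          (swap-removes G₁ u2 y x s distinct₂ G₁-symmetric (≤-trans (s≤s z≤n) u2y-nonSimple) xs-present)
          (≤-trans (swap-≤-added G u1 u2 y w distinct₁ (inj₁ (inj₁ (refl , refl))))
                   (s≤s (subst (_≤ 1) (symmetric y u2) (simple-above u1<y u2)))))
        below : ∀ p q → q < p → 2 ≤ G₂ p q → TypeLe p q u1 u2
        below p q q<p nonSimple
          with sameType? s u2 p q | sameType? y x p q | sameType? w u1 p q | sameType? u2 y p q
        ... | yes (inj₁ (refl , refl)) | _ | _ | _ = inj₁ s<u1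
        ... | yes (inj₂ (refl , refl)) | _ | _ | _ = inj₁ u2<u1
        ... | no _ | yes t | _ | _ = contradiction (≤-trans
                (swap-≤-added G₁ u2 y x s distinct₂ (inj₁ t))
                (s≤s (subst (G₁ p q ≤_) (absent (SameType-flip t) Gxy≡0)
                   (swap-≤-not-added G u1 u2 y w (SameType-miss (SameType-flip t) x≢u2 (≢-sym y≢x))
                                                 (SameType-miss (SameType-flip t) x≢w x≢u1)))))
                (¬nonSimple nonSimple)
        ... | no ¬su2 | no ¬yx | yes t | _ = contradiction (≤-trans
                (swap-≤-not-added G₁ u2 y x s ¬yx ¬su2)
                (subst (λ k → G₁ p q ≤ suc k) (absent t (trans (symmetric w u1) Gu1w≡0))
                   (swap-≤-added G u1 u2 y w distinct₁ (inj₂ t))))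
                (¬nonSimple nonSimple)
        ... | no _ | no _ | no _ | yes t = contradiction
                (subst (_≤ 1) (mult-type (swap-sym G₁ u2 y x s G₁-symmetric) t) removed-again)
                (¬nonSimple nonSimple)
        ... | no ¬su2 | no ¬yx | no ¬wu1 | no ¬u2y = below-max p q q<p (≤-trans nonSimple
                (≤-trans (swap-≤-not-added G₁ u2 y x s ¬yx ¬su2) (swap-≤-not-added G u1 u2 y w ¬u2y ¬wu1)))

    improvement : Σ (Mult n) λ G' → Reachable G G' × (G' ≺ G)
    improvement with G u2 y ℕ.≟ 0
    ... | yes Gu2y≡0 = G₁ , G₁-admissible ◅ ε , G₁-≺ Gu2y≡0
    ... | no Gu2y≢0  = G₂ , G₁-admissible ◅ G₂-admissible u2~y ◅ ε , G₂-≺ u2~y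
      where u2~y = n≢0⇒n>0 Gu2y≢0

open StandingSetup using (private-neighbour; module Reduction)

lemma5p5 : ∀ {n} (G : Mult n) → IsLoopFree G →
    (∀ u v → deg G u Data.Nat.< deg G v → u < v) →
    ¬ (Σ (Mult n) λ G' → Reachable G G' × (G' ≺ G)) →
    ∀ u1 u2 → IsMaxNonSimple G u1 u2 →
    ∀ x → x ≢ u1 → x ≢ u2 →
    (Σ (Fin n) λ s → s ≢ u1 × s ≢ u2 × s < u1 × Adj G x s) →
    ∀ y → y ≢ u1 → y ≢ u2 → u1 < y → y ≢ x → Adj G x y
-- The hypotheses s ≢ u1, y ≢ u1 and y ≢ u2 follow from s < u1 < y.
lemma5p5 G loopFree degree-order irreducible u1 u2 maximal x x≢u1 x≢u2 (s , _ , s≢u2 , s<u1 , x~s)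
         y _ _ u1<y y≢x
  with 1 ℕ.≤? G x y | private-neighbour loopFree maximal degree-order u1<y
... | yes x~y | _ = x~y
... | no x≁y  | w , y~w , w≢u1 , Gu1w≡0 =
  contradiction (Reduction.improvement loopFree maximal x≢u1 x≢u2 s≢u2 s<u1 x~s u1<y y≢x Gxy≡0
                   y~w w≢u1 Gu1w≡0)
                irreducible
  where
  Gxy≡0 : G x y ≡ 0
  Gxy≡0 = ℕₚ.n<1⇒n≡0 (≰⇒> x≁y)
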